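{- Suppose the balanced composition $(a_1,\ldots,a_k\,|\,b_m,\ldots,b_1)$ of $n$ is cyclic and $a_k=b_m$. Then $a_k=b_m=k=m=1$ and $n=2$.
   Context: A composition of $n$ is a tuple of positive integers with sum $n$. The reverse layered permutation associated to a composition $(c_1,\ldots,c_r)$ of $n$ is $I_{c_1}\ominus\cdots\ominus I_{c_r}$, i.e. in one-line notation $(n-c_1+1)\cdots(n)\,(n-c_1-c_2+1)\cdots(n-c_1)\cdots(1)\cdots(c_r)$: the values are split into consecutive blocks of sizes $c_1,\ldots,c_r$, the blocks appear in decreasing order of values, each block increasing. The composition is cyclic if this permutation is a single $n$-cycle. The notation $(a_1,\ldots,a_k\,|\,b_m,\ldots,b_1)$ denotes the composition $(a_1,\ldots,a_k,b_m,\ldots,b_1)$ of $n$ with $a_1+\cdots+a_k=b_1+\cdots+b_m=n/2$ (a balanced composition). -}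

module Defs where

open import Data.Nat using (ℕ; zero; suc; _+_; _∸_; _<_; _<ᵇ_)
open import Data.Bool using (if_then_else_)
open import Data.List using (List; []; _∷_)
open import Data.Nat.ListAction using (sum)
open import Data.List.Relation.Unary.All using (All)
open import Data.Product using (∃)
open import Relation.Binary.PropositionalEquality using (_≡_)

-- A composition: a list of positive integers (its sum is the integer composed).
IsComposition : List ℕ → Set
IsComposition cs = All (λ c → 0 < c) cs

-- The reverse layered permutation I_{c1} ⊖ ... ⊖ I_{cr}, written 0-indexed
-- on {0,...,n-1} with n = sum cs: position p in block t (block t starts at
-- s_t = c1+...+c_{t-1}) is sent to the value (c_{t+1}+...+c_r) + (p - s_t).
-- Outside {0..n-1} it is irrelevant.
revLayered : List ℕ → ℕ → ℕ
revLayered []       p = p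
revLayered (c ∷ cs) p = if p <ᵇ c then sum cs + p else revLayered cs (p ∸ c)

iter : (ℕ → ℕ) → ℕ → ℕ → ℕ
iter f zero    x = x
iter f (suc j) x = f (iter f j x)

-- A permutation σ of {0,...,n-1} is a single n-cycle iff it has exactly one orbit.
IsNCycle : ℕ → (ℕ → ℕ) → Set
IsNCycle n σ = ∀ x y → x < n → y < n → ∃ λ j → iter σ j x ≡ y

IsCyclic : List ℕ → Set
IsCyclic cs = IsNCycle (sum cs) (revLayered cs)

module Submission where

-- Write s = a_1 + ... + a_{k-1}.  When a_k = b_m = a the
-- composition is  as ++ a ∷ a ∷ r  with r = (b_{m-1},...,b_1) and
-- sum r = s, so the two central blocks have equal size.  Each block of the
-- reverse layered permutation σ is mapped, in order, onto an interval of
-- values (revLayered-block); hence the first position s of the first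
-- central block goes to s + a, and the first position s + a of the second
-- central block goes back to s.  So σ contains the transposition (s, s+a).
-- An n-cycle containing a transposition only moves those two points, so
-- every z < n = 2(s + a) equals s or s + a (ncycle-transposition); this
-- forces s = 0 and a = 1 (transposition-fills-range).  Positive parts with
-- sum 0 form the empty list, so k = m = 1 and n = 2.

open import Defs
open import Data.Nat using (ℕ; zero; suc; _+_; _<_; _<ᵇ_; s≤s; z≤n; z<s)
open import Data.Nat.Properties
  using (+-identityʳ; +-assoc; +-comm; +-cancelʳ-≡; m+n∸m≡n; m<m+n; m≤m+n; m≤n+m; ≤-trans; <⇒<ᵇ)
open import Data.Nat.ListAction using (sum)
open import Data.Nat.ListAction.Properties using (sum-++; sum-↭)
open import Data.List using (List; []; _∷_; _++_; _∷ʳ_; length; reverse)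
open import Data.List.Properties using (++-assoc; reverse-++; reverse-involutive)
open import Data.List.Relation.Binary.Permutation.Propositional.Properties using (↭-reverse)
open import Data.List.Relation.Unary.All using (All; []; _∷_)
open import Data.List.Relation.Unary.All.Properties using (++⁻)
open import Data.Bool using (true; false)
open import Data.Bool.Properties using (T-≡)
open import Data.Sum using (_⊎_; inj₁; inj₂)
open import Data.Product using (_×_; _,_; proj₁; proj₂)
open import Function.Bundles using (Equivalence)
open import Relation.Binary.PropositionalEquality
open ≡-Reasoning

<ᵇ-inside : ∀ {p c} → p < c → (p <ᵇ c) ≡ true
<ᵇ-inside p<c = Equivalence.to T-≡ (<⇒<ᵇ p<c)

<ᵇ-beyond : ∀ c q → (c + q <ᵇ c) ≡ false
<ᵇ-beyond zero    q = refl
<ᵇ-beyond (suc c) q = <ᵇ-beyond c q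

revLayered-block : ∀ xs c ys p → p < c →
                   revLayered (xs ++ c ∷ ys) (sum xs + p) ≡ sum ys + p
revLayered-block []       c ys p p<c rewrite <ᵇ-inside p<c = refl
revLayered-block (x ∷ xs) c ys p p<c
  rewrite +-assoc x (sum xs) p | <ᵇ-beyond x (sum xs + p) | m+n∸m≡n x (sum xs + p)
  = revLayered-block xs c ys p p<c

revLayered-block-start : ∀ xs c ys → 0 < c → revLayered (xs ++ c ∷ ys) (sum xs) ≡ sum ys
revLayered-block-start xs c ys 0<c = begin
  revLayered (xs ++ c ∷ ys) (sum xs)      ≡⟨ cong (revLayered (xs ++ c ∷ ys)) (sym (+-identityʳ (sum xs))) ⟩
  revLayered (xs ++ c ∷ ys) (sum xs + 0)  ≡⟨ revLayered-block xs c ys 0 0<c ⟩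
  sum ys + 0                              ≡⟨ +-identityʳ (sum ys) ⟩
  sum ys                                  ∎

iter-transposition : ∀ (σ : ℕ → ℕ) {x y} → σ x ≡ y → σ y ≡ x →
                     ∀ j → iter σ j x ≡ x ⊎ iter σ j x ≡ y
iter-transposition σ x↦y y↦x zero = inj₁ refl
iter-transposition σ x↦y y↦x (suc j) with iter-transposition σ x↦y y↦x j
... | inj₁ at-x = inj₂ (trans (cong σ at-x) x↦y)
... | inj₂ at-y = inj₁ (trans (cong σ at-y) y↦x)

-- An n-cycle that swaps two points x, y (with x < n) has no other points:
-- the orbit of x is all of {0,...,n-1} and is contained in {x, y}.
ncycle-transposition : ∀ n (σ : ℕ → ℕ) {x y} → IsNCycle n σ → σ x ≡ y → σ y ≡ x → x < n →
                       ∀ z → z < n → z ≡ x ⊎ z ≡ y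
ncycle-transposition n σ cyc x↦y y↦x x<n z z<n with cyc _ z x<n z<n
... | j , reaches-z with iter-transposition σ x↦y y↦x j
...   | inj₁ at-x = inj₁ (trans (sym reaches-z) at-x)
...   | inj₂ at-y = inj₂ (trans (sym reaches-z) at-y)

-- If the only numbers below 2(s + a) are s and s + a, with a > 0, then
-- s = 0 (test z = 0) and a = 1 (test z = 1).
transposition-fills-range : ∀ s a → 0 < a →
                            (∀ z → z < s + (a + (a + s)) → z ≡ s ⊎ z ≡ s + a) →
                            (s ≡ 0) × (a ≡ 1)
transposition-fills-range (suc s) a 0<a covers with covers 0 z<s
... | inj₁ ()
... | inj₂ ()
transposition-fills-range zero (suc a) 0<a covers
  with covers 1 (s≤s (≤-trans (s≤s z≤n) (m≤n+m (suc (a + 0)) a)))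
... | inj₁ ()
... | inj₂ 1≡1+a = refl , sym 1≡1+a

positive-sum-zero : ∀ xs → All (0 <_) xs → sum xs ≡ 0 → xs ≡ []
positive-sum-zero []      _         _  = refl
positive-sum-zero (_ ∷ _) (0<x ∷ _) eq with 0<x | eq
... | z<s | ()

sum-∷ʳ : ∀ xs x → sum (xs ∷ʳ x) ≡ sum xs + x
sum-∷ʳ xs x = begin
  sum (xs ++ x ∷ [])   ≡⟨ sum-++ xs (x ∷ []) ⟩
  sum xs + (x + 0)     ≡⟨ cong (sum xs +_) (+-identityʳ x) ⟩
  sum xs + x           ∎

equal-central-blocks : ∀ as a r →
                       IsComposition (as ++ a ∷ a ∷ r) → sum r ≡ sum as →
                       IsCyclic (as ++ a ∷ a ∷ r) →
                       (as ≡ []) × (a ≡ 1) × (r ≡ [])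
equal-central-blocks as a r comp sum-r cyc with ++⁻ as comp
... | pos-as , (0<a ∷ _ ∷ pos-r) = as≡[] , a≡1 , r≡[]
  where
  c : List ℕ
  c = as ++ a ∷ a ∷ r

  s : ℕ
  s = sum as

  first-block : revLayered c s ≡ s + a
  first-block = begin
    revLayered c s  ≡⟨ revLayered-block-start as a (a ∷ r) 0<a ⟩
    a + sum r       ≡⟨ cong (a +_) sum-r ⟩
    a + s           ≡⟨ +-comm a s ⟩
    s + a           ∎

  second-block : revLayered c (s + a) ≡ s
  second-block = begin
    revLayered c (s + a)                             ≡⟨ cong₂ revLayered (sym (++-assoc as (a ∷ []) (a ∷ r)))
                                                                         (sym (sum-∷ʳ as a)) ⟩
    revLayered ((as ∷ʳ a) ++ a ∷ r) (sum (as ∷ʳ a))  ≡⟨ revLayered-block-start (as ∷ʳ a) a r 0<a ⟩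
    sum r                                            ≡⟨ sum-r ⟩
    s                                                ∎

  size : sum c ≡ s + (a + (a + s))
  size = trans (sum-++ as (a ∷ a ∷ r)) (cong (λ t → s + (a + (a + t))) sum-r)

  s<size : s < sum c
  s<size = subst (s <_) (sym size) (m<m+n s (≤-trans 0<a (m≤m+n a (a + s))))

  covers : ∀ z → z < s + (a + (a + s)) → z ≡ s ⊎ z ≡ s + a
  covers z z<n = ncycle-transposition (sum c) (revLayered c) cyc first-block second-block s<size
                   z (subst (z <_) (sym size) z<n)

  s≡0×a≡1 : (s ≡ 0) × (a ≡ 1)
  s≡0×a≡1 = transposition-fills-range s a 0<a covers

  as≡[] : as ≡ []
  as≡[] = positive-sum-zero as pos-as (proj₁ s≡0×a≡1)

  a≡1 : a ≡ 1
  a≡1 = proj₂ s≡0×a≡1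

  r≡[] : r ≡ []
  r≡[] = positive-sum-zero r pos-r (trans sum-r (proj₁ s≡0×a≡1))

central-layout : ∀ as bs (a : ℕ) → (as ∷ʳ a) ++ reverse (bs ∷ʳ a) ≡ as ++ a ∷ a ∷ reverse bs
central-layout as bs a = begin
  (as ∷ʳ a) ++ reverse (bs ∷ʳ a)   ≡⟨ cong ((as ∷ʳ a) ++_) (reverse-++ bs (a ∷ [])) ⟩
  (as ∷ʳ a) ++ a ∷ reverse bs      ≡⟨ ++-assoc as (a ∷ []) (a ∷ reverse bs) ⟩
  as ++ a ∷ a ∷ reverse bs         ∎

balanced-outer-sums : ∀ as bs a → sum (as ∷ʳ a) ≡ sum (bs ∷ʳ a) → sum (reverse bs) ≡ sum as
balanced-outer-sums as bs a balanced = begin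
  sum (reverse bs)  ≡⟨ sum-↭ (↭-reverse bs) ⟩
  sum bs            ≡⟨ +-cancelʳ-≡ a (sum bs) (sum as) balanced′ ⟩
  sum as            ∎
  where
  balanced′ : sum bs + a ≡ sum as + a
  balanced′ = trans (sym (sum-∷ʳ bs a)) (trans (sym balanced) (sum-∷ʳ as a))

reverse-≡[] : ∀ {A : Set} (xs : List A) → reverse xs ≡ [] → xs ≡ []
reverse-≡[] xs rev≡[] = trans (sym (reverse-involutive xs)) (cong reverse rev≡[])

lemma3p1 : (as bs : List ℕ) (a b : ℕ) →
    let A = as ∷ʳ a
        B = bs ∷ʳ b
        c = A ++ reverse B
    in IsComposition c →
       sum A ≡ sum B →
       IsCyclic c →
       a ≡ b →
       (a ≡ 1) × (b ≡ 1) × (length A ≡ 1) × (length B ≡ 1) × (sum c ≡ 2)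
lemma3p1 as bs a .a comp balanced cyc refl
  with equal-central-blocks as a (reverse bs)
         (subst IsComposition (central-layout as bs a) comp)
         (balanced-outer-sums as bs a balanced)
         (subst IsCyclic (central-layout as bs a) cyc)
... | refl , refl , reverse-bs≡[] with reverse-≡[] bs reverse-bs≡[]
...   | refl = refl , refl , refl , refl , refl
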